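{- For every integer $d\ge 3$, $\mu(\mathit{CCC}_d)\ge 2^{\lceil d/2\rceil-1}$.
   Context: For a connected graph $G$ and $X\subseteq V(G)$, two vertices $x,y\in V(G)$ are $X$-visible if there is a shortest $x,y$-path none of whose internal vertices lies in $X$. $X$ is a mutual-visibility set if every two vertices of $X$ are $X$-visible; $\mu(G)$ is the maximum cardinality of a mutual-visibility set of $G$. For $d\ge 3$, the cube-connected cycle $\mathit{CCC}_d$ has vertex set $\{[\ell,x] : \ell\in\{0,\dots,d-1\},\ x\in\{0,1\}^d\}$, where bit positions of $x$ are numbered $0,\dots,d-1$ from the left; $[\ell,x]$ and $[\ell',x']$ are adjacent if and only if either $x=x'$ and $\ell'\equiv \ell\pm 1 \pmod d$, or $\ell=\ell'$ and $x'$ is obtained from $x$ by complementing the bit in position $\ell$. -}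

module Defs where

open import Data.Nat using (ℕ; zero; suc; _≤_)
open import Data.Fin using (Fin; toℕ)
open import Data.Bool using (Bool; not)
open import Data.Vec using (Vec; _[_]%=_)
open import Data.Product using (_×_; _,_)
open import Data.Sum using (_⊎_)
open import Data.List using (List; []; _∷_)
open import Data.List.Membership.Propositional using (_∈_; _∉_)
open import Data.List.Relation.Unary.All using (All)
open import Relation.Binary.PropositionalEquality using (_≡_)

-- Vertices of CCC_d: pairs [ℓ , x] with ℓ ∈ {0..d-1}, x ∈ {0,1}^d.
-- Bit position i of x (numbered from the left) is the Vec index i.
Vertex : ℕ → Set
Vertex d = Fin d × Vec Bool d

CycSucc : {d : ℕ} → Fin d → Fin d → Set
CycSucc {d} ℓ ℓ' = (suc (toℕ ℓ) ≡ toℕ ℓ') ⊎ ((suc (toℕ ℓ) ≡ d) × (toℕ ℓ' ≡ 0))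

Adj : (d : ℕ) → Vertex d → Vertex d → Set
Adj d (ℓ , x) (ℓ' , x') =
  ((x ≡ x') × (CycSucc ℓ ℓ' ⊎ CycSucc ℓ' ℓ))
  ⊎ ((ℓ ≡ ℓ') × (x' ≡ x [ ℓ ]%= not))

data Walk (d : ℕ) : Vertex d → Vertex d → Set where
  [] : {u : Vertex d} → Walk d u u
  _∷_ : {u v w : Vertex d} → Adj d u v → Walk d v w → Walk d u w

len : {d : ℕ} {u v : Vertex d} → Walk d u v → ℕ
len [] = 0
len (_ ∷ p) = suc (len p)

internal : {d : ℕ} {u v : Vertex d} → Walk d u v → List (Vertex d)
internal [] = []
internal (_ ∷ []) = []
internal (_∷_ {v = v} _ (a ∷ p)) = v ∷ internal (a ∷ p)

IsShortest : {d : ℕ} {u v : Vertex d} → Walk d u v → Set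
IsShortest {d} {u} {v} p = (q : Walk d u v) → len p ≤ len q

Visible : {d : ℕ} → List (Vertex d) → Vertex d → Vertex d → Set
Visible {d} X u v =
  Data.Product.Σ (Walk d u v) (λ p → IsShortest p × All (λ w → w ∉ X) (internal p))

IsMutualVisibility : {d : ℕ} → List (Vertex d) → Set
IsMutualVisibility {d} X = (u v : Vertex d) → u ∈ X → v ∈ X → Visible X u v

-- Write d = 1 + k + r with k = ⌊(d − 1)/2⌋ ≤ r = ⌈(d − 1)/2⌉, and let X consist of the 2^k
-- vertices [0, 0 w 0…0] with w ∈ {0,1}^k.  For a target [0, y] ∈ X, let D(z) be the set of
-- positions in 1…k where z and y differ, and let Φ[ℓ, z] = |D(z)| + max over t ∈ {0} ∪ D(z) of
-- (t + cyclic distance from ℓ to t); for ℓ ≤ k the second term is the length of the shortest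
-- cycle walk from ℓ through D(z) back to 0.  Φ changes by at most one along every edge and
-- vanishes at the target, so it bounds the distance to the target from below.  Starting from a
-- vertex of X and greedily taking an edge that lowers Φ (flip a differing bit at the current
-- level, else climb towards a higher differing position, else descend towards 0) therefore
-- yields a shortest path, and all its internal vertices lie at levels 1…k, off X.

module Submission where

open import Defs
open import Data.Bool using (Bool; true; false; not; _xor_; if_then_else_)
open import Data.Bool.Properties using (not-distribˡ-xor; xor-same; ¬-not) renaming (_≟_ to _≟ᵇ_)
open import Data.Empty using (⊥-elim)
open import Data.Fin using (Fin; toℕ; fromℕ<; inject₁) renaming (zero to fzero; suc to fsuc)
open import Data.Fin.Properties using (toℕ-fromℕ<; toℕ-inject₁)
open import Data.List using (List; map; length) renaming ([] to []ᴸ; _∷_ to _∷ᴸ_; _++_ to _++ᴸ_)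
open import Data.List.Properties using (length-map; length-++)
open import Data.List.Membership.Propositional using (_∈_)
open import Data.List.Membership.Propositional.Properties using (∈-map⁻)
open import Data.List.Relation.Unary.All as All using (All)
open import Data.List.Relation.Unary.Unique.Propositional using (Unique) renaming ([] to []ᵁ; _∷_ to _∷ᵁ_)
open import Data.List.Relation.Unary.Unique.Propositional.Properties using (map⁺; ++⁺)
open import Data.Nat
open import Data.Nat.Properties
open import Data.Product using (Σ; ∃; _×_; _,_; proj₁; proj₂)
open import Data.Sum using (_⊎_; inj₁; inj₂; [_,_]′)
open import Data.Vec using (Vec; []; _∷_; _[_]%=_; _++_; replicate)
open import Data.Vec.Properties using (++-injectiveˡ; ∷-injectiveʳ)
open import Function using (_∘_)
open import Relation.Nullary using (¬_; Dec; yes; no)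
open import Relation.Nullary.Decidable using (_×-dec_)
open import Relation.Binary.PropositionalEquality

-- Positions beyond the length of the vector read as false.
bit : ∀ {n} → Vec Bool n → ℕ → Bool
bit []      _       = false
bit (b ∷ v) zero    = b
bit (b ∷ v) (suc i) = bit v i

bit-flip-here : ∀ {n} (z : Vec Bool n) (ℓ : Fin n) → bit (z [ ℓ ]%= not) (toℕ ℓ) ≡ not (bit z (toℕ ℓ))
bit-flip-here (b ∷ z) fzero    = refl
bit-flip-here (b ∷ z) (fsuc ℓ) = bit-flip-here z ℓ

bit-flip-elsewhere : ∀ {n} (z : Vec Bool n) (ℓ : Fin n) {i} → i ≢ toℕ ℓ → bit (z [ ℓ ]%= not) i ≡ bit z i
bit-flip-elsewhere (b ∷ z) fzero    {zero}  i≢ℓ = ⊥-elim (i≢ℓ refl)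
bit-flip-elsewhere (b ∷ z) fzero    {suc i} i≢ℓ = refl
bit-flip-elsewhere (b ∷ z) (fsuc ℓ) {zero}  i≢ℓ = refl
bit-flip-elsewhere (b ∷ z) (fsuc ℓ) {suc i} i≢ℓ = bit-flip-elsewhere z ℓ (i≢ℓ ∘ cong suc)

bit-extensionality : ∀ {n} {z y : Vec Bool n} → (∀ i → bit z i ≡ bit y i) → z ≡ y
bit-extensionality {z = []}    {[]}    _ = refl
bit-extensionality {z = a ∷ z} {b ∷ y} h = cong₂ _∷_ (h 0) (bit-extensionality (h ∘ suc))

bit-replicate-false : ∀ r i → bit (replicate r false) i ≡ false
bit-replicate-false zero    i       = refl
bit-replicate-false (suc r) zero    = refl
bit-replicate-false (suc r) (suc i) = bit-replicate-false r i

bit-padding : ∀ {m} (w : Vec Bool m) r {i} → m ≤ i → bit (w ++ replicate r false) i ≡ false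
bit-padding []      r {i}     _         = bit-replicate-false r i
bit-padding (b ∷ w) r {suc i} (s≤s m≤i) = bit-padding w r m≤i

xor≡false⇒≡ : ∀ a b → a xor b ≡ false → a ≡ b
xor≡false⇒≡ true  true  _ = refl
xor≡false⇒≡ false false _ = refl

fromBool : Bool → ℕ
fromBool b = if b then 1 else 0

WithinOne : ℕ → ℕ → Set
WithinOne a b = a ≤ suc b × b ≤ suc a

WithinOne-refl : ∀ a → WithinOne a a
WithinOne-refl a = n≤1+n a , n≤1+n a

WithinOne-sym : ∀ {a b} → WithinOne a b → WithinOne b a
WithinOne-sym (a≤1+b , b≤1+a) = b≤1+a , a≤1+b

WithinOne-fromBool : ∀ b c → WithinOne (fromBool b) (fromBool c)
WithinOne-fromBool true  true  = WithinOne-refl 1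
WithinOne-fromBool true  false = ≤-refl , z≤n
WithinOne-fromBool false true  = z≤n , ≤-refl
WithinOne-fromBool false false = WithinOne-refl 0

WithinOne-⊔ : ∀ {a b c e} → WithinOne a b → WithinOne c e → WithinOne (a ⊔ c) (b ⊔ e)
WithinOne-⊔ {a} {b} {c} {e} (a≤ , b≤) (c≤ , e≤) =
  ⊔-lub (≤-trans a≤ (s≤s (m≤m⊔n b e))) (≤-trans c≤ (s≤s (m≤n⊔m b e))) ,
  ⊔-lub (≤-trans b≤ (s≤s (m≤m⊔n a c))) (≤-trans e≤ (s≤s (m≤n⊔m a c)))

WithinOne-⊓ : ∀ {a b c e} → WithinOne a b → WithinOne c e → WithinOne (a ⊓ c) (b ⊓ e)
WithinOne-⊓ {a} {b} {c} {e} (a≤ , b≤) (c≤ , e≤) =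
  ⊓-glb (≤-trans (m⊓n≤m a c) a≤) (≤-trans (m⊓n≤n a c) c≤) ,
  ⊓-glb (≤-trans (m⊓n≤m b e) b≤) (≤-trans (m⊓n≤n b e) e≤)

WithinOne-+ˡ : ∀ t {a b} → WithinOne a b → WithinOne (t + a) (t + b)
WithinOne-+ˡ t {a} {b} (a≤ , b≤) =
  subst (t + a ≤_) (+-suc t b) (+-monoʳ-≤ t a≤) , subst (t + b ≤_) (+-suc t a) (+-monoʳ-≤ t b≤)

WithinOne-+ʳ : ∀ t {a b} → WithinOne a b → WithinOne (a + t) (b + t)
WithinOne-+ʳ t (a≤ , b≤) = +-monoˡ-≤ t a≤ , +-monoˡ-≤ t b≤

m∸n≤1+[m∸1+n] : ∀ m n → m ∸ n ≤ suc (m ∸ suc n)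
m∸n≤1+[m∸1+n] zero    zero    = z≤n
m∸n≤1+[m∸1+n] zero    (suc n) = z≤n
m∸n≤1+[m∸1+n] (suc m) zero    = ≤-refl
m∸n≤1+[m∸1+n] (suc m) (suc n) = m∸n≤1+[m∸1+n] m n

WithinOne-∸ : ∀ d {a b} → WithinOne a b → WithinOne (d ∸ a) (d ∸ b)
WithinOne-∸ d {a} {b} (a≤ , b≤) =
  ≤-trans (m∸n≤1+[m∸1+n] d a) (s≤s (∸-monoʳ-≤ d b≤)) ,
  ≤-trans (m∸n≤1+[m∸1+n] d b) (s≤s (∸-monoʳ-≤ d a≤))

WithinOne-∣-∣ : ∀ a j → WithinOne ∣ a - j ∣ ∣ suc a - j ∣
WithinOne-∣-∣ zero    zero    = z≤n , ≤-refl
WithinOne-∣-∣ zero    (suc j) = ≤-refl , m≤n+m j 2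
WithinOne-∣-∣ (suc a) zero    = m≤n+m (suc a) 2 , ≤-refl
WithinOne-∣-∣ (suc a) (suc j) = WithinOne-∣-∣ a j

WithinOne-⊓-suc : ∀ e j → WithinOne (e ⊓ suc j) (j ⊓ suc e)
WithinOne-⊓-suc e j = bound e j , bound j e
  where
    bound : ∀ e j → e ⊓ suc j ≤ suc (j ⊓ suc e)
    bound e j = ⊓-glb (m⊓n≤n e (suc j)) (≤-trans (m⊓n≤m e (suc j)) (≤-trans (n≤1+n e) (n≤1+n (suc e))))

m≤n⇒m+∣n-m∣≡n : ∀ {m n} → m ≤ n → m + ∣ n - m ∣ ≡ n
m≤n⇒m+∣n-m∣≡n {m} m≤n = trans (cong (m +_) (m≤n⇒∣n-m∣≡n∸m m≤n)) (m+[n∸m]≡n m≤n)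

m<n⇒∣m-n∣≡1+∣1+m-n∣ : ∀ {m n} → m < n → ∣ m - n ∣ ≡ suc ∣ suc m - n ∣
m<n⇒∣m-n∣≡1+∣1+m-n∣ {zero}  {suc n} _         = refl
m<n⇒∣m-n∣≡1+∣1+m-n∣ {suc m} {suc n} (s≤s m<n) = m<n⇒∣m-n∣≡1+∣1+m-n∣ m<n

m<n⇒1+m<n+∣m-n∣ : ∀ {m n} → m < n → suc m < n + ∣ m - n ∣
m<n⇒1+m<n+∣m-n∣ {m} {n} m<n = begin-strict
  suc m                    ≤⟨ m<n ⟩
  n                        <⟨ n<1+n n ⟩
  suc n                    ≤⟨ s≤s (m≤m+n n _) ⟩
  suc (n + ∣ suc m - n ∣)  ≡⟨ +-suc n _ ⟨
  n + suc ∣ suc m - n ∣    ≡⟨ cong (n +_) (m<n⇒∣m-n∣≡1+∣1+m-n∣ m<n) ⟨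
  n + ∣ m - n ∣            ∎
  where open ≤-Reasoning

cycDist : ℕ → ℕ → ℕ → ℕ
cycDist d a j = ∣ a - j ∣ ⊓ (d ∸ ∣ a - j ∣)

cycDist-suc : ∀ d a j → WithinOne (cycDist d a j) (cycDist d (suc a) j)
cycDist-suc d a j = WithinOne-⊓ (WithinOne-∣-∣ a j) (WithinOne-∸ d (WithinOne-∣-∣ a j))

cycDist-wrap : ∀ {d a j} → suc a ≡ d → j ≤ a → WithinOne (cycDist d a j) (cycDist d 0 j)
cycDist-wrap {a = a} {j} refl j≤a = subst₂ WithinOne (sym from-a) (sym from-0) (WithinOne-⊓-suc (a ∸ j) j)
  where
    from-a : cycDist (suc a) a j ≡ (a ∸ j) ⊓ suc j
    from-a = begin
      ∣ a - j ∣ ⊓ (suc a ∸ ∣ a - j ∣)  ≡⟨ cong (λ t → t ⊓ (suc a ∸ t)) (m≤n⇒∣n-m∣≡n∸m j≤a) ⟩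
      (a ∸ j) ⊓ (suc a ∸ (a ∸ j))      ≡⟨ cong ((a ∸ j) ⊓_) (+-∸-assoc 1 (m∸n≤m a j)) ⟩
      (a ∸ j) ⊓ suc (a ∸ (a ∸ j))      ≡⟨ cong (λ t → (a ∸ j) ⊓ suc t) (m∸[m∸n]≡n j≤a) ⟩
      (a ∸ j) ⊓ suc j                  ∎
      where open ≡-Reasoning
    from-0 : cycDist (suc a) 0 j ≡ j ⊓ suc (a ∸ j)
    from-0 = cong (j ⊓_) (+-∸-assoc 1 j≤a)

cycDist-cycSucc : ∀ {d} {ℓ ℓ' : Fin d} j → j < d → CycSucc ℓ ℓ' →
                  WithinOne (cycDist d (toℕ ℓ) j) (cycDist d (toℕ ℓ') j)
cycDist-cycSucc {d} {ℓ} j _ (inj₁ e) =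
  subst (λ t → WithinOne (cycDist d (toℕ ℓ) j) (cycDist d t j)) e (cycDist-suc d (toℕ ℓ) j)
cycDist-cycSucc {d} {ℓ} j j<d (inj₂ (last , ℓ'≡0)) =
  subst (λ t → WithinOne (cycDist d (toℕ ℓ) j) (cycDist d t j)) (sym ℓ'≡0)
        (cycDist-wrap last (≤-pred (subst (j <_) (sym last) j<d)))

module _ {d : ℕ} (Φ : Vertex d → ℕ) {v : Vertex d} where

  Φ≤len : (∀ {w w'} → Adj d w w' → Φ w ≤ suc (Φ w')) → Φ v ≡ 0 → ∀ {w} (q : Walk d w v) → Φ w ≤ len q
  Φ≤len _     Φv≡0 []      = ≤-reflexive Φv≡0
  Φ≤len Φ-adj Φv≡0 (e ∷ q) = ≤-trans (Φ-adj e) (s≤s (Φ≤len Φ-adj Φv≡0 q))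

  DescentStep : (Inv Q : Vertex d → Set) → Vertex d → Set
  DescentStep Inv Q w =
    w ≡ v ⊎ Σ (Vertex d) λ w' → Adj d w w' × Φ w' < Φ w × Inv w' × (Q w' ⊎ Φ w' ≡ 0)

  All-internal-∷ : ∀ {Q : Vertex d → Set} {w w' u} (e : Adj d w w') (p : Walk d w' u) →
                   Q w' ⊎ len p ≡ 0 → All Q (internal p) → All Q (internal (e ∷ p))
  All-internal-∷ e []      _          _  = All.[]
  All-internal-∷ e (_ ∷ p) (inj₁ Qw') qs = Qw' All.∷ qs

  descent-walk : ∀ {Inv Q : Vertex d → Set} → (∀ w → Inv w → DescentStep Inv Q w) →
                 ∀ n w → Inv w → Φ w ≤ n → Σ (Walk d w v) λ p → len p ≤ Φ w × All Q (internal p)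
  descent-walk {Q = Q} step n w inv Φw≤n with step w inv
  ... | inj₁ refl = [] , z≤n , All.[]
  ... | inj₂ (w' , e , Φw'<Φw , inv' , Q⊎0) with n
  ...   | zero = ⊥-elim (n≮0 (<-≤-trans Φw'<Φw Φw≤n))
  ...   | suc n with descent-walk step n w' inv' (≤-pred (≤-trans Φw'<Φw Φw≤n))
  ...     | p , p≤Φw' , qs = e ∷ p , ≤-trans (s≤s p≤Φw') Φw'<Φw , All-internal-∷ e p Q⊎len≡0 qs
    where
      Q⊎len≡0 : Q w' ⊎ len p ≡ 0
      Q⊎len≡0 = [ inj₁ , (λ Φw'≡0 → inj₂ (n≤0⇒n≡0 (subst (len p ≤_) Φw'≡0 p≤Φw'))) ]′ Q⊎0

  shortest-by-descent : ∀ {Inv Q : Vertex d → Set} →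
                        (∀ {w w'} → Adj d w w' → Φ w ≤ suc (Φ w')) → Φ v ≡ 0 →
                        (∀ w → Inv w → DescentStep Inv Q w) →
                        ∀ {u} → Inv u → Σ (Walk d u v) λ p → IsShortest p × All Q (internal p)
  shortest-by-descent Φ-adj Φv≡0 step {u} inv with descent-walk step (Φ u) u inv ≤-refl
  ... | p , p≤Φu , qs = p , (λ q → ≤-trans p≤Φu (Φ≤len Φ-adj Φv≡0 q)) , qs

module DistanceTo (k r : ℕ) (k≤r : k ≤ r) (y : Vec Bool (suc (k + r))) where

  d : ℕ
  d = suc (k + r)

  k<d : k < d
  k<d = s≤s (m≤m+n k r)

  target : Vertex d
  target = fzero , y

  differs : Vec Bool d → ℕ → Bool
  differs z i = bit z i xor bit y i

  detour : ℕ → Vec Bool d → ℕ → ℕ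
  detour a z i = if differs z i then i + cycDist d a i else 0

  tour : ℕ → Vec Bool d → ℕ → ℕ
  tour a z zero    = cycDist d a 0
  tour a z (suc j) = tour a z j ⊔ detour a z (suc j)

  mismatches : Vec Bool d → ℕ → ℕ
  mismatches z zero    = 0
  mismatches z (suc j) = fromBool (differs z (suc j)) + mismatches z j

  Φ : Vertex d → ℕ
  Φ (ℓ , z) = mismatches z k + tour (toℕ ℓ) z k

  cycDist-low : ∀ {a j} → a ≤ k → j ≤ k → cycDist d a j ≡ ∣ a - j ∣
  cycDist-low {a} {j} a≤k j≤k = m≤n⇒m⊓n≡m (begin
    ∣ a - j ∣          ≤⟨ δ≤k ⟩
    k                  ≤⟨ k≤r ⟩
    r                  <⟨ n<1+n r ⟩
    suc r              ≡⟨ m+n∸m≡n k (suc r) ⟨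
    k + suc r ∸ k      ≡⟨ cong (_∸ k) (+-suc k r) ⟩
    d ∸ k              ≤⟨ ∸-monoʳ-≤ d δ≤k ⟩
    d ∸ ∣ a - j ∣      ∎)
    where
      open ≤-Reasoning
      δ≤k : ∣ a - j ∣ ≤ k
      δ≤k = ≤-trans (∣m-n∣≤m⊔n a j) (⊔-lub a≤k j≤k)

  cycDist-low-0 : ∀ {a} → a ≤ k → cycDist d a 0 ≡ a
  cycDist-low-0 {a} a≤k = trans (cycDist-low a≤k z≤n) (∣-∣-identityʳ a)

  detour-low : ∀ {a} z {i} → differs z i ≡ true → a ≤ k → i ≤ k → detour a z i ≡ i + ∣ a - i ∣
  detour-low {a} z {i} differ a≤k i≤k =
    trans (cong (λ b → if b then i + cycDist d a i else 0) differ) (cong (i +_) (cycDist-low a≤k i≤k))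

  detour-matched : ∀ {a} z {i} → differs z i ≡ false → detour a z i ≡ 0
  detour-matched {a} z {i} match = cong (λ b → if b then i + cycDist d a i else 0) match

  detour-≤-level : ∀ {a} z {i} → a ≤ k → i ≤ a → detour a z i ≤ a
  detour-≤-level {a} z {i} a≤k i≤a with differs z i
  ... | true  = ≤-reflexive (trans (cong (i +_) (cycDist-low a≤k (≤-trans i≤a a≤k))) (m≤n⇒m+∣n-m∣≡n i≤a))
  ... | false = z≤n

  tour-≥-start : ∀ a z j → cycDist d a 0 ≤ tour a z j
  tour-≥-start a z zero    = ≤-refl
  tour-≥-start a z (suc j) = ≤-trans (tour-≥-start a z j) (m≤m⊔n _ _)

  tour-≥-detour : ∀ a z {i} j → 1 ≤ i → i ≤ j → detour a z i ≤ tour a z j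
  tour-≥-detour a z     zero    1≤i i≤0 = ⊥-elim (<⇒≱ 1≤i i≤0)
  tour-≥-detour a z {i} (suc j) 1≤i i≤1+j with m≤n⇒m<n∨m≡n i≤1+j
  ... | inj₁ i<1+j = ≤-trans (tour-≥-detour a z j 1≤i (≤-pred i<1+j)) (m≤m⊔n _ _)
  ... | inj₂ refl  = m≤n⊔m (tour a z j) _

  tour-< : ∀ {a z B} j → cycDist d a 0 < B → (∀ i → 1 ≤ i → i ≤ j → detour a z i < B) → tour a z j < B
  tour-< zero    start<B _          = start<B
  tour-< (suc j) start<B detours<B =
    ⊔-lub (tour-< j start<B (λ i 1≤i i≤j → detours<B i 1≤i (m≤n⇒m≤1+n i≤j))) (detours<B (suc j) z<s ≤-refl)

  tour-settled : ∀ {a z} → a ≤ k → (∀ i → a < i → i ≤ k → differs z i ≡ false) → tour a z k < suc a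
  tour-settled {a} {z} a≤k matched = tour-< k (s≤s (≤-reflexive (cycDist-low-0 a≤k))) bound
    where
      bound : ∀ i → 1 ≤ i → i ≤ k → detour a z i < suc a
      bound i _ i≤k with i ≤? a
      ... | yes i≤a = s≤s (detour-≤-level z a≤k i≤a)
      ... | no  i≰a = subst (_< suc a) (sym (detour-matched {a} z (matched i (≰⇒> i≰a) i≤k))) z<s

  tour-own-level : ∀ z j → suc j ≤ k → tour (suc j) z (suc j) ≡ tour (suc j) z j
  tour-own-level z j 1+j≤k = m≥n⇒m⊔n≡m (begin
    detour (suc j) z (suc j)  ≤⟨ detour-≤-level z 1+j≤k ≤-refl ⟩
    suc j                     ≡⟨ cycDist-low-0 1+j≤k ⟨
    cycDist d (suc j) 0       ≤⟨ tour-≥-start (suc j) z j ⟩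
    tour (suc j) z j          ∎)
    where open ≤-Reasoning

  ascend-tour : ∀ {a z i} → suc a ≤ k → a < i → i ≤ k → differs z i ≡ true → tour (suc a) z k < tour a z k
  ascend-tour {a} {z} {i} 1+a≤k a<i i≤k differ = tour-< k (subst (_< B) (sym (cycDist-low-0 1+a≤k)) 1+a<B) detours
    where
      B : ℕ
      B = tour a z k
      reached : ∀ {j} → a < j → j ≤ k → differs z j ≡ true → j + ∣ a - j ∣ ≤ B
      reached {j} a<j j≤k differ' =
        subst (_≤ B) (detour-low z differ' (≤-trans (n≤1+n a) 1+a≤k) j≤k) (tour-≥-detour a z k (≤-trans z<s a<j) j≤k)
      1+a<B : suc a < B
      1+a<B = <-≤-trans (m<n⇒1+m<n+∣m-n∣ a<i) (reached a<i i≤k differ)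
      above : ∀ {j} → suc a < j → j ≤ k → detour (suc a) z j < B
      above {j} 1+a<j j≤k with differs z j in differ'
      ... | false = ≤-trans z<s 1+a<B
      ... | true  = begin-strict
        j + cycDist d (suc a) j  ≡⟨ cong (j +_) (cycDist-low 1+a≤k j≤k) ⟩
        j + ∣ suc a - j ∣        <⟨ +-monoʳ-< j (≤-reflexive (sym (m<n⇒∣m-n∣≡1+∣1+m-n∣ a<j))) ⟩
        j + ∣ a - j ∣            ≤⟨ reached a<j j≤k differ' ⟩
        B                        ∎
        where
          open ≤-Reasoning
          a<j : a < j
          a<j = <-trans (n<1+n a) 1+a<j
      detours : ∀ j → 1 ≤ j → j ≤ k → detour (suc a) z j < B
      detours j _ j≤k with j ≤? suc a
      ... | yes j≤1+a = ≤-<-trans (detour-≤-level z 1+a≤k j≤1+a) 1+a<B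
      ... | no  j≰1+a = above (≰⇒> j≰1+a) j≤k

  detour-cycSucc : ∀ {ℓ ℓ' : Fin d} z i → i < d → CycSucc ℓ ℓ' →
                   WithinOne (detour (toℕ ℓ) z i) (detour (toℕ ℓ') z i)
  detour-cycSucc z i i<d c with differs z i
  ... | true  = WithinOne-+ˡ i (cycDist-cycSucc i i<d c)
  ... | false = WithinOne-refl 0

  tour-cycSucc : ∀ {ℓ ℓ' : Fin d} z j → j < d → CycSucc ℓ ℓ' →
                 WithinOne (tour (toℕ ℓ) z j) (tour (toℕ ℓ') z j)
  tour-cycSucc z zero    j<d c = cycDist-cycSucc 0 j<d c
  tour-cycSucc z (suc j) j<d c = WithinOne-⊔ (tour-cycSucc z j (<-trans (n<1+n j) j<d) c) (detour-cycSucc z (suc j) j<d c)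

  AgreeExcept : ℕ → Vec Bool d → Vec Bool d → Set
  AgreeExcept a z z' = ∀ i → i ≢ a → differs z' i ≡ differs z i

  differs-flip-here : ∀ z ℓ → differs (z [ ℓ ]%= not) (toℕ ℓ) ≡ not (differs z (toℕ ℓ))
  differs-flip-here z ℓ =
    trans (cong (_xor bit y (toℕ ℓ)) (bit-flip-here z ℓ)) (sym (not-distribˡ-xor (bit z (toℕ ℓ)) (bit y (toℕ ℓ))))

  differs-flip-elsewhere : ∀ z ℓ → AgreeExcept (toℕ ℓ) z (z [ ℓ ]%= not)
  differs-flip-elsewhere z ℓ i i≢ℓ = cong (_xor bit y i) (bit-flip-elsewhere z ℓ i≢ℓ)

  tour-agree : ∀ {a z z'} → AgreeExcept a z z' → ∀ j → j ≤ k → tour a z' j ≡ tour a z j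
  tour-agree agree zero _ = refl
  tour-agree {a} {z} {z'} agree (suc j) 1+j≤k with suc j ≟ a
  ... | yes refl = begin
    tour (suc j) z' (suc j)  ≡⟨ tour-own-level z' j 1+j≤k ⟩
    tour (suc j) z' j        ≡⟨ tour-agree agree j (≤-pred (m≤n⇒m≤1+n 1+j≤k)) ⟩
    tour (suc j) z j         ≡⟨ tour-own-level z j 1+j≤k ⟨
    tour (suc j) z (suc j)   ∎
    where open ≡-Reasoning
  ... | no 1+j≢a = cong₂ _⊔_ (tour-agree agree j (≤-pred (m≤n⇒m≤1+n 1+j≤k)))
                             (cong (λ b → if b then suc j + cycDist d a (suc j) else 0) (agree (suc j) 1+j≢a))

  mismatches-cong : ∀ z z' j → (∀ i → 1 ≤ i → i ≤ j → differs z' i ≡ differs z i) →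
                    mismatches z' j ≡ mismatches z j
  mismatches-cong z z' zero    _     = refl
  mismatches-cong z z' (suc j) agree =
    cong₂ _+_ (cong fromBool (agree (suc j) z<s ≤-refl))
              (mismatches-cong z z' j (λ i 1≤i i≤j → agree i 1≤i (m≤n⇒m≤1+n i≤j)))

  mismatches-none : ∀ z j → (∀ i → 1 ≤ i → i ≤ j → differs z i ≡ false) → mismatches z j ≡ 0
  mismatches-none z zero    _       = refl
  mismatches-none z (suc j) matched =
    cong₂ _+_ (cong fromBool (matched (suc j) z<s ≤-refl))
              (mismatches-none z j (λ i 1≤i i≤j → matched i 1≤i (m≤n⇒m≤1+n i≤j)))

  agree-below : ∀ {a} z z' → AgreeExcept a z z' →
                ∀ j → j < a → ∀ i → 1 ≤ i → i ≤ j → differs z' i ≡ differs z i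
  agree-below z z' agree j j<a i _ i≤j = agree i (<⇒≢ (≤-<-trans i≤j j<a))

  mismatches-withinOne : ∀ {a z z'} → AgreeExcept a z z' → ∀ j → WithinOne (mismatches z' j) (mismatches z j)
  mismatches-withinOne agree zero = WithinOne-refl 0
  mismatches-withinOne {a} {z} {z'} agree (suc j) with suc j ≟ a
  ... | yes refl =
    subst (λ m → WithinOne (fromBool (differs z' (suc j)) + m) (mismatches z (suc j)))
          (sym (mismatches-cong z z' j (agree-below z z' agree j ≤-refl)))
          (WithinOne-+ʳ (mismatches z j) (WithinOne-fromBool (differs z' (suc j)) (differs z (suc j))))
  ... | no 1+j≢a rewrite agree (suc j) 1+j≢a =
    WithinOne-+ˡ (fromBool (differs z (suc j))) (mismatches-withinOne agree j)

  mismatches-swap : ∀ {a z z'} → AgreeExcept a z z' → 1 ≤ a → ∀ j → a ≤ j →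
                    mismatches z' j + fromBool (differs z a) ≡ mismatches z j + fromBool (differs z' a)
  mismatches-swap agree 1≤a zero a≤0 = ⊥-elim (<⇒≱ 1≤a a≤0)
  mismatches-swap {a} {z} {z'} agree 1≤a (suc j) a≤1+j with a ≟ suc j
  ... | yes refl = begin
    t' + mismatches z' j + t  ≡⟨ cong (λ m → t' + m + t) (mismatches-cong z z' j (agree-below z z' agree j ≤-refl)) ⟩
    t' + mismatches z j + t   ≡⟨ +-comm (t' + mismatches z j) t ⟩
    t + (t' + mismatches z j) ≡⟨ cong (t +_) (+-comm t' (mismatches z j)) ⟩
    t + (mismatches z j + t') ≡⟨ +-assoc t (mismatches z j) t' ⟨
    t + mismatches z j + t'   ∎
    where
      open ≡-Reasoning
      t t' : ℕ
      t  = fromBool (differs z (suc j))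
      t' = fromBool (differs z' (suc j))
  ... | no a≢1+j = begin
    t' + mismatches z' j + c   ≡⟨ cong (λ s → s + mismatches z' j + c) (cong fromBool (agree (suc j) (a≢1+j ∘ sym))) ⟩
    t + mismatches z' j + c    ≡⟨ +-assoc t (mismatches z' j) c ⟩
    t + (mismatches z' j + c)  ≡⟨ cong (t +_) (mismatches-swap agree 1≤a j (≤-pred (≤∧≢⇒< a≤1+j a≢1+j))) ⟩
    t + (mismatches z j + c')  ≡⟨ +-assoc t (mismatches z j) c' ⟨
    t + mismatches z j + c'    ∎
    where
      open ≡-Reasoning
      t t' c c' : ℕ
      t  = fromBool (differs z (suc j))
      t' = fromBool (differs z' (suc j))
      c  = fromBool (differs z a)
      c' = fromBool (differs z' a)

  Φ-withinOne : ∀ {w w'} → Adj d w w' → WithinOne (Φ w) (Φ w')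
  Φ-withinOne {ℓ , z} (inj₁ (refl , inj₁ c)) = WithinOne-+ˡ (mismatches z k) (tour-cycSucc z k k<d c)
  Φ-withinOne {ℓ , z} (inj₁ (refl , inj₂ c)) = WithinOne-sym (WithinOne-+ˡ (mismatches z k) (tour-cycSucc z k k<d c))
  Φ-withinOne {ℓ , z} (inj₂ (refl , refl)) =
    subst (λ t → WithinOne (Φ (ℓ , z)) (mismatches z' k + t)) (sym (tour-agree agree k ≤-refl))
          (WithinOne-+ʳ (tour (toℕ ℓ) z k) (WithinOne-sym (mismatches-withinOne agree k)))
    where
      z' : Vec Bool d
      z' = z [ ℓ ]%= not
      agree : AgreeExcept (toℕ ℓ) z z'
      agree = differs-flip-elsewhere z ℓ

  Φ-target : Φ target ≡ 0
  Φ-target = cong₂ _+_ (mismatches-none y k (λ i _ _ → xor-same (bit y i)))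
                       (n<1⇒n≡0 (tour-settled z≤n (λ i _ _ → xor-same (bit y i))))

  AgreesOutside : Vec Bool d → Set
  AgreesOutside z = ∀ i → (i ≡ 0 ⊎ k < i) → bit z i ≡ bit y i

  Inv : Vertex d → Set
  Inv (ℓ , z) = toℕ ℓ ≤ k × AgreesOutside z

  OffLevel0 : Vertex d → Set
  OffLevel0 (ℓ , _) = toℕ ℓ ≢ 0

  Step : Vertex d → Set
  Step = DescentStep Φ {target} Inv OffLevel0

  MismatchAbove : ℕ → Vec Bool d → Set
  MismatchAbove a z = ∃ λ i → i < suc k × a < i × differs z i ≡ true

  mismatchAbove? : ∀ a z → Dec (MismatchAbove a z)
  mismatchAbove? a z = anyUpTo? (λ i → a <? i ×-dec (differs z i ≟ᵇ true)) (suc k)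

  matchedAbove : ∀ {a} z → ¬ MismatchAbove a z → ∀ i → a < i → i ≤ k → differs z i ≡ false
  matchedAbove z none i a<i i≤k = ¬-not (λ differ → none (i , s≤s i≤k , a<i , differ))

  flip-step : ∀ {ℓ z} → toℕ ℓ ≢ 0 → differs z (toℕ ℓ) ≡ true → Inv (ℓ , z) → Step (ℓ , z)
  flip-step {ℓ} {z} a≢0 differ (a≤k , outside) =
    inj₂ ((ℓ , z') , inj₂ (refl , refl) , Φ-decreases , (a≤k , outside') , inj₁ a≢0)
    where
      open ≡-Reasoning
      a : ℕ
      a = toℕ ℓ
      z' : Vec Bool d
      z' = z [ ℓ ]%= not
      agree : AgreeExcept a z z'
      agree = differs-flip-elsewhere z ℓ
      fewer : suc (mismatches z' k) ≡ mismatches z k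
      fewer = begin
        suc (mismatches z' k)                   ≡⟨ +-comm 1 (mismatches z' k) ⟩
        mismatches z' k + fromBool true         ≡⟨ cong (λ b → mismatches z' k + fromBool b) differ ⟨
        mismatches z' k + fromBool (differs z a) ≡⟨ mismatches-swap agree (n≢0⇒n>0 a≢0) k a≤k ⟩
        mismatches z k + fromBool (differs z' a) ≡⟨ cong (λ b → mismatches z k + fromBool b)
                                                         (trans (differs-flip-here z ℓ) (cong not differ)) ⟩
        mismatches z k + 0                      ≡⟨ +-identityʳ (mismatches z k) ⟩
        mismatches z k                          ∎
      Φ-decreases : Φ (ℓ , z') < Φ (ℓ , z)
      Φ-decreases = subst (λ t → mismatches z' k + t < Φ (ℓ , z)) (sym (tour-agree agree k ≤-refl))
                          (+-monoˡ-< (tour a z k) (≤-reflexive fewer))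
      outside' : AgreesOutside z'
      outside' i (inj₁ i≡0) =
        trans (bit-flip-elsewhere z ℓ (λ i≡a → a≢0 (trans (sym i≡a) i≡0))) (outside i (inj₁ i≡0))
      outside' i (inj₂ k<i) =
        trans (bit-flip-elsewhere z ℓ (λ i≡a → <⇒≱ k<i (subst (_≤ k) (sym i≡a) a≤k))) (outside i (inj₂ k<i))

  ascend-step : ∀ {ℓ ℓ' z} → suc (toℕ ℓ) ≡ toℕ ℓ' → Inv (ℓ , z) → MismatchAbove (toℕ ℓ) z → Step (ℓ , z)
  ascend-step {ℓ} {ℓ'} {z} e (_ , outside) (i , i<1+k , a<i , differ) =
    inj₂ ((ℓ' , z) , inj₁ (refl , inj₁ (inj₁ e)) , Φ-decreases ,
          (subst (_≤ k) e 1+a≤k , outside) , inj₁ (1+n≢0 ∘ trans e))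
    where
      1+a≤k : suc (toℕ ℓ) ≤ k
      1+a≤k = ≤-trans a<i (≤-pred i<1+k)
      Φ-decreases : Φ (ℓ' , z) < Φ (ℓ , z)
      Φ-decreases = +-monoʳ-< (mismatches z k)
        (subst (λ t → tour t z k < tour (toℕ ℓ) z k) e (ascend-tour 1+a≤k a<i (≤-pred i<1+k) differ))

  descend-step : ∀ {ℓ ℓ' z} → suc (toℕ ℓ') ≡ toℕ ℓ → Inv (ℓ , z) →
                 (∀ i → toℕ ℓ' < i → i ≤ k → differs z i ≡ false) → Step (ℓ , z)
  descend-step {ℓ} {ℓ'} {z} e (a≤k , outside) matched =
    inj₂ ((ℓ' , z) , inj₁ (refl , inj₂ (inj₁ e)) , Φ-decreases , (b≤k , outside) , off-or-done)
    where
      b≤k : toℕ ℓ' ≤ k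
      b≤k = ≤-trans (n≤1+n _) (subst (_≤ k) (sym e) a≤k)
      settled : tour (toℕ ℓ') z k < suc (toℕ ℓ')
      settled = tour-settled b≤k matched
      Φ-decreases : Φ (ℓ' , z) < Φ (ℓ , z)
      Φ-decreases = +-monoʳ-< (mismatches z k)
        (<-≤-trans settled (subst (_≤ tour (toℕ ℓ) z k) (trans (cycDist-low-0 a≤k) (sym e)) (tour-≥-start _ z k)))
      off-or-done : OffLevel0 (ℓ' , z) ⊎ Φ (ℓ' , z) ≡ 0
      off-or-done with toℕ ℓ' ≟ 0
      ... | no  b≢0 = inj₁ b≢0
      ... | yes b≡0 = inj₂ (cong₂ _+_ (mismatches-none z k (λ i 1≤i → matched i (subst (_< i) (sym b≡0) 1≤i)))
                                      (n<1⇒n≡0 (subst (λ t → tour (toℕ ℓ') z k < suc t) b≡0 settled)))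

  at-target : ∀ {z} → AgreesOutside z → (∀ i → 0 < i → i ≤ k → differs z i ≡ false) → (fzero , z) ≡ target
  at-target {z} outside matched = cong (fzero ,_) (bit-extensionality agrees)
    where
      agrees : ∀ i → bit z i ≡ bit y i
      agrees zero = outside 0 (inj₁ refl)
      agrees (suc i) with k <? suc i
      ... | yes k<i = outside (suc i) (inj₂ k<i)
      ... | no  k≮i = xor≡false⇒≡ _ _ (matched (suc i) z<s (≮⇒≥ k≮i))

  step : ∀ w → Inv w → Step w
  step (ℓ , z) inv with mismatchAbove? (toℕ ℓ) z
  step (ℓ , z) inv | yes above@(i , i<1+k , a<i , _) = ascend-step (sym (toℕ-fromℕ< 1+a<d)) inv above
    where
      1+a<d : suc (toℕ ℓ) < d
      1+a<d = s≤s (≤-trans (≤-trans a<i (≤-pred i<1+k)) (m≤m+n k r))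
  step (fzero , z) (_ , outside) | no none = inj₁ (at-target outside (matchedAbove z none))
  step (fsuc ℓ , z) inv | no none with differs z (suc (toℕ ℓ)) in differ
  ... | true  = flip-step (λ ()) differ inv
  ... | false = descend-step (cong suc (toℕ-inject₁ ℓ)) inv matched
    where
      matched : ∀ i → toℕ (inject₁ ℓ) < i → i ≤ k → differs z i ≡ false
      matched i b<i i≤k with m≤n⇒m<n∨m≡n (subst (_< i) (toℕ-inject₁ ℓ) b<i)
      ... | inj₁ 1+b<i = matchedAbove z none i 1+b<i i≤k
      ... | inj₂ refl  = differ

  shortest-to-target : ∀ {u} → Inv u → Σ (Walk d u target) λ p → IsShortest p × All OffLevel0 (internal p)
  shortest-to-target = shortest-by-descent Φ (proj₁ ∘ Φ-withinOne) Φ-target step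

bitVectors : ∀ k → List (Vec Bool k)
bitVectors zero    = [] ∷ᴸ []ᴸ
bitVectors (suc k) = map (true ∷_) (bitVectors k) ++ᴸ map (false ∷_) (bitVectors k)

length-bitVectors : ∀ k → length (bitVectors k) ≡ 2 ^ k
length-bitVectors zero    = refl
length-bitVectors (suc k) = begin
  length (map (true ∷_) vs ++ᴸ map (false ∷_) vs)         ≡⟨ length-++ (map (true ∷_) vs) ⟩
  length (map (true ∷_) vs) + length (map (false ∷_) vs)  ≡⟨ cong₂ _+_ (length-map (true ∷_) vs) (length-map (false ∷_) vs) ⟩
  length vs + length vs                                   ≡⟨ cong (λ n → n + n) (length-bitVectors k) ⟩
  2 ^ k + 2 ^ k                                           ≡⟨ cong (2 ^ k +_) (+-identityʳ (2 ^ k)) ⟨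
  2 ^ suc k                                               ∎
  where
    open ≡-Reasoning
    vs : List (Vec Bool k)
    vs = bitVectors k

bitVectors-unique : ∀ k → Unique (bitVectors k)
bitVectors-unique zero    = All.[] ∷ᵁ []ᵁ
bitVectors-unique (suc k) =
  ++⁺ (map⁺ ∷-injectiveʳ (bitVectors-unique k)) (map⁺ ∷-injectiveʳ (bitVectors-unique k)) disjoint
  where
    disjoint : ∀ {v} → ¬ (v ∈ map (true ∷_) (bitVectors k) × v ∈ map (false ∷_) (bitVectors k))
    disjoint (v∈true , v∈false) with ∈-map⁻ (true ∷_) v∈true | ∈-map⁻ (false ∷_) v∈false
    ... | _ , _ , refl | _ , _ , ()

module _ (k r : ℕ) (k≤r : k ≤ r) where

  embed : Vec Bool k → Vec Bool (suc (k + r))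
  embed w = false ∷ (w ++ replicate r false)

  X : List (Vertex (suc (k + r)))
  X = map (λ w → fzero , embed w) (bitVectors k)

  X-level0 : ∀ {w} → w ∈ X → toℕ (proj₁ w) ≡ 0
  X-level0 w∈X with ∈-map⁻ _ w∈X
  ... | _ , _ , refl = refl

  embed-agreesOutside : ∀ a b → DistanceTo.AgreesOutside k r k≤r (embed b) (embed a)
  embed-agreesOutside a b zero    _                = refl
  embed-agreesOutside a b (suc i) (inj₂ (s≤s k≤i)) = trans (bit-padding a r k≤i) (sym (bit-padding b r k≤i))

  X-mutualVisibility : IsMutualVisibility X
  X-mutualVisibility u v u∈X v∈X with ∈-map⁻ _ u∈X | ∈-map⁻ _ v∈X
  ... | a , _ , refl | b , _ , refl with DistanceTo.shortest-to-target k r k≤r (embed b) (z≤n , embed-agreesOutside a b)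
  ...   | p , shortest , off = p , shortest , All.map (λ off-w w∈X → off-w (X-level0 w∈X)) off

  large-mutualVisibility-set : Σ (List (Vertex (suc (k + r)))) λ X → Unique X × IsMutualVisibility X × 2 ^ k ≤ length X
  large-mutualVisibility-set =
    X , map⁺ (++-injectiveˡ _ _ ∘ ∷-injectiveʳ ∘ cong proj₂) (bitVectors-unique k) , X-mutualVisibility ,
    ≤-reflexive (sym (trans (length-map _ (bitVectors k)) (length-bitVectors k)))

-- The construction works for every d ≥ 1; ⌈ 1 + n /2⌉ ∸ 1 reduces to ⌊ n /2⌋.
lemma5 : (d : ℕ) → 3 ≤ d →
    Σ (List (Vertex d)) (λ X → Unique X × IsMutualVisibility X × 2 ^ (⌈ d /2⌉ ∸ 1) ≤ length X)
lemma5 (suc n) _ =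
  subst (λ d → Σ (List (Vertex d)) λ X → Unique X × IsMutualVisibility X × 2 ^ ⌊ n /2⌋ ≤ length X)
        (cong suc (⌊n/2⌋+⌈n/2⌉≡n n))
        (large-mutualVisibility-set ⌊ n /2⌋ ⌈ n /2⌉ (⌊n/2⌋≤⌈n/2⌉ n))
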